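{- Let $q$ be an odd prime, $r\ge1$, and $K$ a tame cyclic number field of degree $q^r$ with ramified primes $p_1,\dots,p_n$, ramification indices $e_{p_i}$, and $h_i=\frac{p_i-1}{e_{p_i}}$. In the group ring $\mathbb{Z}[G]$, $G=\mathrm{Gal}(K/\mathbb{Q})\cong\mathbb{Z}/q^r\mathbb{Z}$, for $1\le j\le r$ let $\Sigma_{\langle q^j\rangle}$ denote the sum of the elements of the unique subgroup of $G$ of order $q^j$, and let $I$ be the identity element. For $1\le i\le r$ let $\mathbb{P}_i=\{p_k: e_{p_k}=q^i\}$, $m_i=\prod_{p\in\mathbb{P}_i}p$ (empty product $=1$), $f_i=\frac{m_i-1}{q^i}$. Then $$\prod_{k=1}^n\bigl(p_kI-h_k\Sigma_{\langle e_{p_k}\rangle}\bigr)=a_0I+a_1\Sigma_{\langle q\rangle}+\dots+a_r\Sigma_{\langle q^r\rangle}$$ with $a_0=p_1p_2\cdots p_n$ and $a_i=-f_i\prod_{j>i}m_j$ for $1\le i\le r$.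
   Context: A number field is tame if no prime ramifies wildly; cyclic of degree $n$ means Galois over $\mathbb{Q}$ with Galois group $\mathbb{Z}/n\mathbb{Z}$. For each ramified $p_k$, $e_{p_k}$ is a nontrivial power of $q$ dividing $p_k-1$, and $\Sigma_{\langle e_{p_k}\rangle}$ is the sum of the elements of the unique subgroup of $G$ of order $e_{p_k}$. -}

module Defs where

open import Data.Nat using (ℕ; zero; suc; _∸_; _^_; _≡ᵇ_; NonZero)
  renaming (_+_ to _+ℕ_; _*_ to _*ℕ_)
open import Data.Nat.Properties using (m^n≢0)
open import Data.Nat.DivMod using (_/_)
open import Data.Nat.Divisibility using (_∣?_)
open import Data.Nat.Primality using (Prime; prime⇒nonZero)
open import Data.Nat using (_≟_)
open import Data.Integer using (ℤ; +_; _+_; _*_; -_; _-_)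
open import Data.Fin using (Fin; toℕ)
open import Data.Bool using (Bool; if_then_else_; _∨_)
open import Relation.Binary.PropositionalEquality using (_≡_)
open import Relation.Nullary.Decidable using (⌊_⌋; does)

sumFin : ∀ {a} {A : Set a} → (A → A → A) → A → (n : ℕ) → (Fin n → A) → A
sumFin _⊕_ e zero    f = e
sumFin _⊕_ e (suc n) f = f Fin.zero ⊕ sumFin _⊕_ e n (λ k → f (Fin.suc k))

prodℕ : (n : ℕ) → (Fin n → ℕ) → ℕ
prodℕ = sumFin _*ℕ_ 1

sumℤ : (n : ℕ) → (Fin n → ℤ) → ℤ
sumℤ = sumFin _+_ (+ 0)

-- The group ring ℤ[ℤ/Nℤ]: an element is its coefficient function
-- Fin N → ℤ, where x : Fin N stands for the residue class of toℕ x.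

RG : ℕ → Set
RG N = Fin N → ℤ

_≈_ : ∀ {N} → RG N → RG N → Set
f ≈ g = ∀ x → f x ≡ g x

-- x ≡ y + z (mod N) for x y z < N
addIs : (N : ℕ) → Fin N → Fin N → Fin N → Bool
addIs N y z x = does (toℕ y +ℕ toℕ z ≟ toℕ x) ∨ does (toℕ y +ℕ toℕ z ≟ toℕ x +ℕ N)

_⊞_ : ∀ {N} → RG N → RG N → RG N
(f ⊞ g) x = f x + g x

_⊟_ : ∀ {N} → RG N → RG N → RG N
(f ⊟ g) x = f x - g x

_•_ : ∀ {N} → ℤ → RG N → RG N
(c • f) x = c * f x

_⊛_ : ∀ {N} → RG N → RG N → RG N
_⊛_ {N} f g x =
  sumℤ N (λ y → sumℤ N (λ z → if addIs N y z x then f y * g z else + 0))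

𝟙 : ∀ {N} → RG N
𝟙 x = if toℕ x ≡ᵇ 0 then + 1 else + 0

𝟘 : ∀ {N} → RG N
𝟘 x = + 0

-- Σ_{⟨q^j⟩}: sum of the elements of the unique subgroup of order q^j of
-- ℤ/q^r ℤ, namely the multiples of q^(r-j)   (0 ≤ j ≤ r).
Sig : (q r j : ℕ) → RG (q ^ r)
Sig q r j x = if does (q ^ (r ∸ j) ∣? toℕ x) then + 1 else + 0

prodRG : ∀ {N} (n : ℕ) → (Fin n → RG N) → RG N
prodRG = sumFin _⊛_ 𝟙

sumRG : ∀ {N} (n : ℕ) → (Fin n → RG N) → RG N
sumRG = sumFin _⊞_ 𝟘

divPow : (q : ℕ) → Prime q → (a i : ℕ) → ℕ
divPow q pq a i = _/_ a (q ^ i) {{m^n≢0 q i {{prime⇒nonZero pq}}}}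

-- Data of the ramified primes: p k the primes, ι k the exponent with
-- e_{p_k} = q ^ ι k.

hh : (q : ℕ) → Prime q → ∀ {n} → (Fin n → ℕ) → (Fin n → ℕ) → Fin n → ℕ
hh q pq p ι k = divPow q pq (p k ∸ 1) (ι k)

mm : ∀ {n} → (Fin n → ℕ) → (Fin n → ℕ) → ℕ → ℕ
mm {n} p ι i = prodℕ n (λ k → if ι k ≡ᵇ i then p k else 1)

ff : (q : ℕ) → Prime q → ∀ {n} → (Fin n → ℕ) → (Fin n → ℕ) → ℕ → ℕ
ff q pq p ι i = divPow q pq (mm p ι i ∸ 1) i

mmAbove : ∀ {n} → (Fin n → ℕ) → (Fin n → ℕ) → (r i : ℕ) → ℕ
mmAbove p ι r i = prodℕ (r ∸ i) (λ t → mm p ι (i +ℕ suc (toℕ t)))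

a₀ : ∀ {n} → (Fin n → ℕ) → ℤ
a₀ {n} p = + prodℕ n p

aa : (q : ℕ) → Prime q → ∀ {n} → (Fin n → ℕ) → (Fin n → ℕ) → (r i : ℕ) → ℤ
aa q pq p ι r i = - (+ (ff q pq p ι i *ℕ mmAbove p ι r i))

LHS : (q : ℕ) → Prime q → (r n : ℕ) → (Fin n → ℕ) → (Fin n → ℕ) → RG (q ^ r)
LHS q pq r n p ι =
  prodRG n (λ k → ((+ p k) • 𝟙) ⊟ ((+ hh q pq p ι k) • Sig q r (ι k)))

RHS : (q : ℕ) → Prime q → (r n : ℕ) → (Fin n → ℕ) → (Fin n → ℕ) → RG (q ^ r)
RHS q pq r n p ι =
  (a₀ p • 𝟙) ⊞ sumRG r (λ t → aa q pq p ι r (suc (toℕ t)) • Sig q r (suc (toℕ t)))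

{-# OPTIONS --safe #-}
-- Write Σ_t for the sum of the subgroup of order q^t, so Σ_0 = I.  Since
-- Σ_s Σ_t = q^(min s t) Σ_(max s t), every product of factors a I − b Σ_s is an
-- integral combination ∑_{t ≤ r} c_t Σ_t.  Such a combination is determined by the
-- numbers ∑_{t ≤ j} q^t c_t (0 ≤ j ≤ r), which are its images under characters of G
-- of order q^(r−j), hence multiplicative.  On p_k I − h_k Σ_⟨e_k⟩ the j-th value is 1
-- when e_k ≤ q^j (as p_k = 1 + h_k e_k) and p_k otherwise, so the left-hand side has
-- j-th value m_(j+1) ⋯ m_r.  On the right-hand side the same value arises from a
-- telescoping sum, because m_i = 1 + f_i q^i.
module Submission where

open import Defs
open import Data.Bool using (true; false; if_then_else_)
open import Data.Fin using (Fin; zero; suc; toℕ; fromℕ<)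
import Data.Fin.Properties as Fin
open import Data.Integer using (ℤ; +_; _+_; _*_; -_; _-_)
import Data.Integer.Properties as ℤ
open import Data.Integer.Tactic.RingSolver using (solve-∀)
open import Data.Nat
  using ( ℕ; zero; suc; pred; _∸_; _^_; _≤_; _<_; _⊓_; _⊔_; _≟_; _≤?_
        ; NonZero; >-nonZero⁻¹; z≤n; s≤s)
  renaming (_+_ to _+ℕ_; _*_ to _*ℕ_)
import Data.Nat.Properties as ℕ
open import Data.Nat.DivMod using (m/n*n≡m)
open import Data.Nat.Divisibility
  using (_∣_; _∣?_; divides; ∣-refl; ∣-trans; _∣0; ∣⇒≤; ∣m∣n⇒∣m+n; ∣m+n∣m⇒∣n; m∣m*n)
open import Data.Nat.Primality using (Prime; prime⇒nonZero)
open import Data.Product using (∃-syntax; _×_; _,_)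
open import Data.Sum using (_⊎_; inj₁; inj₂)
open import Function using (_∘_; _⇔_; mk⇔)
open import Function.Definitions using (Injective)
open import Relation.Binary.PropositionalEquality
open import Relation.Binary.Definitions using (tri<; tri≈; tri>)
open import Relation.Nullary using (Dec; yes; no; does; ¬_; contradiction)
open import Relation.Nullary.Decidable using (dec-true; dec-false; does-⇔; _⊎-dec_)

open import Algebra.Properties.CommutativeSemigroup ℤ.+-commutativeSemigroup
  using () renaming (interchange to +-interchange)
open import Algebra.Properties.CommutativeSemigroup ℤ.*-commutativeSemigroup
  using () renaming (x∙yz≈y∙xz to x*yz≡y*xz; xy∙z≈y∙xz to xy*z≡y*xz)

open import Algebra.Properties.CommutativeSemigroup ℕ.*-commutativeSemigroup
  using () renaming (interchange to *-interchange)
import Data.Nat.Tactic.RingSolver as ℕ-Solver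

open ≡-Reasoning

sumFin-cong : ∀ {a} {A : Set a} (_⊕_ : A → A → A) (e : A) n {f g : Fin n → A} →
              (∀ k → f k ≡ g k) → sumFin _⊕_ e n f ≡ sumFin _⊕_ e n g
sumFin-cong _⊕_ e zero    f≗g = refl
sumFin-cong _⊕_ e (suc n) f≗g = cong₂ _⊕_ (f≗g zero) (sumFin-cong _⊕_ e n (f≗g ∘ suc))

sumFin-homo : ∀ {a b} {A : Set a} {B : Set b} {_⊕_ : A → A → A} {e : A}
              {_⊗_ : B → B → B} {e′ : B} (h : A → B) →
              h e ≡ e′ → (∀ u v → h (u ⊕ v) ≡ h u ⊗ h v) →
              ∀ n (f : Fin n → A) → h (sumFin _⊕_ e n f) ≡ sumFin _⊗_ e′ n (h ∘ f)
sumFin-homo h h-e h-⊕ zero    f = h-e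
sumFin-homo {_⊗_ = _⊗_} h h-e h-⊕ (suc n) f =
  trans (h-⊕ _ _) (cong (h (f zero) ⊗_) (sumFin-homo h h-e h-⊕ n (f ∘ suc)))

sumℤ-cong : ∀ n {f g : Fin n → ℤ} → (∀ k → f k ≡ g k) → sumℤ n f ≡ sumℤ n g
sumℤ-cong = sumFin-cong _+_ (+ 0)

sumℤ-zero : ∀ n {f : Fin n → ℤ} → (∀ k → f k ≡ + 0) → sumℤ n f ≡ + 0
sumℤ-zero zero    f≗0 = refl
sumℤ-zero (suc n) f≗0 = cong₂ _+_ (f≗0 zero) (sumℤ-zero n (f≗0 ∘ suc))

sumℤ-+ : ∀ n (f g : Fin n → ℤ) → sumℤ n (λ k → f k + g k) ≡ sumℤ n f + sumℤ n g
sumℤ-+ zero    f g = refl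
sumℤ-+ (suc n) f g = begin
  f zero + g zero + sumℤ n (λ k → f (suc k) + g (suc k))
    ≡⟨ cong (_+_ (f zero + g zero)) (sumℤ-+ n (f ∘ suc) (g ∘ suc)) ⟩
  f zero + g zero + (sumℤ n (f ∘ suc) + sumℤ n (g ∘ suc))
    ≡⟨ +-interchange (f zero) (g zero) _ _ ⟩
  f zero + sumℤ n (f ∘ suc) + (g zero + sumℤ n (g ∘ suc)) ∎

sumℤ-linear : ∀ n (a b : ℤ) (f g : Fin n → ℤ) →
              sumℤ n (λ k → a * f k - b * g k) ≡ a * sumℤ n f - b * sumℤ n g
sumℤ-linear zero    a b f g = sym (cong₂ _-_ (ℤ.*-zeroʳ a) (ℤ.*-zeroʳ b))
sumℤ-linear (suc n) a b f g = begin
  a * f zero - b * g zero + sumℤ n (λ k → a * f (suc k) - b * g (suc k))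
    ≡⟨ cong (_+_ (a * f zero - b * g zero)) (sumℤ-linear n a b (f ∘ suc) (g ∘ suc)) ⟩
  a * f zero - b * g zero + (a * sumℤ n (f ∘ suc) - b * sumℤ n (g ∘ suc))
    ≡⟨ regroup a b (f zero) (g zero) _ _ ⟩
  a * (f zero + sumℤ n (f ∘ suc)) - b * (g zero + sumℤ n (g ∘ suc)) ∎
  where
  regroup : ∀ a b x y u v → a * x - b * y + (a * u - b * v) ≡ a * (x + u) - b * (y + v)
  regroup = solve-∀

sumℤ-*ˡ : ∀ n (a : ℤ) (f : Fin n → ℤ) → a * sumℤ n f ≡ sumℤ n (λ k → a * f k)
sumℤ-*ˡ zero    a f = ℤ.*-zeroʳ a
sumℤ-*ˡ (suc n) a f =
  trans (ℤ.*-distribˡ-+ a (f zero) _) (cong (_+_ (a * f zero)) (sumℤ-*ˡ n a (f ∘ suc)))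

sumℤ-*ʳ : ∀ n (a : ℤ) (f : Fin n → ℤ) → sumℤ n f * a ≡ sumℤ n (λ k → f k * a)
sumℤ-*ʳ n a f = trans (ℤ.*-comm _ a)
  (trans (sumℤ-*ˡ n a f) (sumℤ-cong n (λ k → ℤ.*-comm a (f k))))

sumℤ-comm : ∀ m n (F : Fin m → Fin n → ℤ) →
            sumℤ m (λ i → sumℤ n (F i)) ≡ sumℤ n (λ j → sumℤ m (λ i → F i j))
sumℤ-comm zero    n F = sym (sumℤ-zero n (λ _ → refl))
sumℤ-comm (suc m) n F = begin
  sumℤ n (F zero) + sumℤ m (λ i → sumℤ n (F (suc i)))
    ≡⟨ cong (_+_ (sumℤ n (F zero))) (sumℤ-comm m n (F ∘ suc)) ⟩
  sumℤ n (F zero) + sumℤ n (λ j → sumℤ m (λ i → F (suc i) j))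
    ≡⟨ sumℤ-+ n (F zero) _ ⟨
  sumℤ n (λ j → F zero j + sumℤ m (λ i → F (suc i) j)) ∎

*-distribʳ-linear : ∀ a b u v w → (a * u - b * v) * w ≡ a * (u * w) - b * (v * w)
*-distribʳ-linear = solve-∀

prodℕ-* : ∀ n (f g : Fin n → ℕ) → prodℕ n (λ k → f k *ℕ g k) ≡ prodℕ n f *ℕ prodℕ n g
prodℕ-* zero    f g = refl
prodℕ-* (suc n) f g = trans (cong (_*ℕ_ (f zero *ℕ g zero)) (prodℕ-* n (f ∘ suc) (g ∘ suc)))
                            (*-interchange (f zero) (g zero) _ _)

prodℕ-ones : ∀ n {f : Fin n → ℕ} → (∀ k → f k ≡ 1) → prodℕ n f ≡ 1
prodℕ-ones zero    _   = refl
prodℕ-ones (suc n) f≗1 = cong₂ _*ℕ_ (f≗1 zero) (prodℕ-ones n (f≗1 ∘ suc))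

prodℤ : (n : ℕ) → (Fin n → ℤ) → ℤ
prodℤ = sumFin _*_ (+ 1)

if-yes : ∀ {A B : Set} (a? : Dec A) {x y : B} → A → (if does a? then x else y) ≡ x
if-yes a? a rewrite dec-true a? a = refl

if-no : ∀ {A B : Set} (a? : Dec A) {x y : B} → ¬ A → (if does a? then x else y) ≡ y
if-no a? ¬a rewrite dec-false a? ¬a = refl

if-elim : ∀ {A B : Set} (P : B → Set) (a? : Dec A) {x y : B} →
          (A → P x) → (¬ A → P y) → P (if does a? then x else y)
if-elim P (yes a) Px _  = Px a
if-elim P (no ¬a) _  Py = Py ¬a

*-if-zeroˡ : ∀ b (a x : ℤ) → a * (if b then x else + 0) ≡ (if b then a * x else + 0)
*-if-zeroˡ true  a x = refl
*-if-zeroˡ false a x = ℤ.*-zeroʳ a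

*-if-zeroʳ : ∀ b (x a : ℤ) → (if b then x else + 0) * a ≡ (if b then x * a else + 0)
*-if-zeroʳ true  x a = refl
*-if-zeroʳ false x a = refl

sumℤ-collapse : ∀ {n} {P : Fin n → Set} (P? : ∀ k → Dec (P k)) (g : Fin n → ℤ) k₀ →
                P k₀ → (∀ k → P k → k ≡ k₀) →
                sumℤ n (λ k → if does (P? k) then g k else + 0) ≡ g k₀
sumℤ-collapse {suc n} P? g zero P₀ unique =
  trans (cong₂ _+_ (if-yes (P? zero) P₀)
                   (sumℤ-zero n (λ k → if-no (P? (suc k)) (Fin.0≢1+n ∘ sym ∘ unique (suc k)))))
        (ℤ.+-identityʳ (g zero))
sumℤ-collapse {suc n} P? g (suc k₀) P₀ unique =
  trans (cong₂ _+_ (if-no (P? zero) (Fin.0≢1+n ∘ unique zero))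
                   (sumℤ-collapse (P? ∘ suc) (g ∘ suc) k₀ P₀
                                  (λ k → Fin.suc-injective ∘ unique (suc k))))
        (ℤ.+-identityˡ (g (suc k₀)))

∑< : ℕ → (ℕ → ℤ) → ℤ
∑< n g = sumℤ n (λ k → g (toℕ k))

∑<-cong : ∀ n {g h : ℕ → ℤ} → (∀ t → t < n → g t ≡ h t) → ∑< n g ≡ ∑< n h
∑<-cong n g≗h = sumℤ-cong n (λ k → g≗h (toℕ k) (Fin.toℕ<n k))

∑<-zero : ∀ n {g : ℕ → ℤ} → (∀ t → t < n → g t ≡ + 0) → ∑< n g ≡ + 0
∑<-zero n g≗0 = sumℤ-zero n (λ k → g≗0 (toℕ k) (Fin.toℕ<n k))

∑<-+ : ∀ n (g h : ℕ → ℤ) → ∑< n (λ t → g t + h t) ≡ ∑< n g + ∑< n h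
∑<-+ n g h = sumℤ-+ n (g ∘ toℕ) (h ∘ toℕ)

∑<-split : ∀ m n (g : ℕ → ℤ) → ∑< (m +ℕ n) g ≡ ∑< m g + ∑< n (λ t → g (m +ℕ t))
∑<-split zero    n g = sym (ℤ.+-identityˡ _)
∑<-split (suc m) n g =
  trans (cong (_+_ (g 0)) (∑<-split m n (g ∘ suc))) (sym (ℤ.+-assoc (g 0) _ _))

∑<-δ : ∀ {n k} → k < n → (g : ℕ → ℤ) →
       ∑< n (λ t → if does (t ≟ k) then g t else + 0) ≡ g k
∑<-δ {n} {k} k<n g =
  trans (sumℤ-collapse (λ t → toℕ t ≟ k) (g ∘ toℕ) (fromℕ< k<n) (Fin.toℕ-fromℕ< k<n)
                       (λ t t≡k → Fin.toℕ-injective (trans t≡k (sym (Fin.toℕ-fromℕ< k<n)))))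
        (cong g (Fin.toℕ-fromℕ< k<n))

pushforward : ℕ → (ℕ → ℕ) → (ℕ → ℤ) → ℕ → ℤ
pushforward n m G t = ∑< n (λ t′ → if does (t ≟ m t′) then G t′ else + 0)

∑<-pushforward : ∀ n n′ (m : ℕ → ℕ) (G F : ℕ → ℤ) → (∀ t′ → t′ < n′ → m t′ < n) →
                 ∑< n (λ t → pushforward n′ m G t * F t) ≡ ∑< n′ (λ t′ → G t′ * F (m t′))
∑<-pushforward n n′ m G F m< = begin
  ∑< n (λ t → pushforward n′ m G t * F t)
    ≡⟨ ∑<-cong n (λ t _ → distrib t) ⟩
  ∑< n (λ t → ∑< n′ (λ t′ → if does (t ≟ m t′) then G t′ * F t else + 0))
    ≡⟨ sumℤ-comm n n′ _ ⟩
  ∑< n′ (λ t′ → ∑< n (λ t → if does (t ≟ m t′) then G t′ * F t else + 0))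
    ≡⟨ ∑<-cong n′ (λ t′ t′<n′ → ∑<-δ (m< t′ t′<n′) (λ t → G t′ * F t)) ⟩
  ∑< n′ (λ t′ → G t′ * F (m t′)) ∎
  where
  distrib : ∀ t → pushforward n′ m G t * F t
                  ≡ ∑< n′ (λ t′ → if does (t ≟ m t′) then G t′ * F t else + 0)
  distrib t = trans (sumℤ-*ʳ n′ (F t) (λ t′ → if does (t ≟ m (toℕ t′)) then G (toℕ t′) else + 0))
                    (sumℤ-cong n′ (λ t′ → *-if-zeroʳ (does (t ≟ m (toℕ t′))) (G (toℕ t′)) (F t)))

𝟙[_∣_] : ℕ → ℕ → ℤ
𝟙[ d ∣ k ] = if does (d ∣? k) then + 1 else + 0

𝟙[∣]-yes : ∀ {d k} → d ∣ k → 𝟙[ d ∣ k ] ≡ + 1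
𝟙[∣]-yes {d} {k} = if-yes (d ∣? k)

𝟙[∣]-no : ∀ {d k} → ¬ d ∣ k → 𝟙[ d ∣ k ] ≡ + 0
𝟙[∣]-no {d} {k} = if-no (d ∣? k)

𝟙[∣]-cong : ∀ d {k l} → (d ∣ k ⇔ d ∣ l) → 𝟙[ d ∣ k ] ≡ 𝟙[ d ∣ l ]
𝟙[∣]-cong d {k} {l} k⇔l = cong (λ b → if b then + 1 else + 0) (does-⇔ k⇔l (d ∣? k) (d ∣? l))

∑<-𝟙[∣]-period : ∀ d .{{_ : NonZero d}} → ∑< d (λ k → 𝟙[ d ∣ k ]) ≡ + 1
∑<-𝟙[∣]-period (suc d) = cong₂ _+_ (𝟙[∣]-yes (suc d ∣0))
  (∑<-zero d (λ k k<d → 𝟙[∣]-no (λ d∣k → ℕ.<⇒≱ (s≤s k<d) (∣⇒≤ d∣k))))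

∑<-𝟙[∣] : ∀ d .{{_ : NonZero d}} b → ∑< (d *ℕ b) (λ k → 𝟙[ d ∣ k ]) ≡ + b
∑<-𝟙[∣] d zero = cong (λ n → ∑< n (λ k → 𝟙[ d ∣ k ])) (ℕ.*-zeroʳ d)
∑<-𝟙[∣] d (suc b) = begin
  ∑< (d *ℕ suc b) (λ k → 𝟙[ d ∣ k ])
    ≡⟨ cong (λ n → ∑< n (λ k → 𝟙[ d ∣ k ])) (ℕ.*-suc d b) ⟩
  ∑< (d +ℕ d *ℕ b) (λ k → 𝟙[ d ∣ k ])
    ≡⟨ ∑<-split d (d *ℕ b) (λ k → 𝟙[ d ∣ k ]) ⟩
  ∑< d (λ k → 𝟙[ d ∣ k ]) + ∑< (d *ℕ b) (λ k → 𝟙[ d ∣ d +ℕ k ])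
    ≡⟨ cong₂ _+_ (∑<-𝟙[∣]-period d) (∑<-cong (d *ℕ b) (λ k _ → 𝟙[∣]-cong d (shift k))) ⟩
  + 1 + ∑< (d *ℕ b) (λ k → 𝟙[ d ∣ k ])
    ≡⟨ cong (_+_ (+ 1)) (∑<-𝟙[∣] d b) ⟩
  + suc b ∎
  where
  shift : ∀ k → d ∣ d +ℕ k ⇔ d ∣ k
  shift k = mk⇔ (λ d∣d+k → ∣m+n∣m⇒∣n d∣d+k ∣-refl) (∣m∣n⇒∣m+n ∣-refl)

AddsTo : ℕ → ℕ → ℕ → ℕ → Set
AddsTo N y z x = y +ℕ z ≡ x ⊎ y +ℕ z ≡ x +ℕ N

addsTo? : ∀ N y z x → Dec (AddsTo N y z x)
addsTo? N y z x = (y +ℕ z ≟ x) ⊎-dec (y +ℕ z ≟ x +ℕ N)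

addIs-comm : ∀ {N} (y z x : Fin N) → addIs N y z x ≡ addIs N z y x
addIs-comm {N} y z x =
  cong (λ s → does ((s ≟ toℕ x) ⊎-dec (s ≟ toℕ x +ℕ N))) (ℕ.+-comm (toℕ y) (toℕ z))

wraps-twice : ∀ {N y z z′ x} → y +ℕ z ≡ x → y +ℕ z′ ≡ x +ℕ N → ¬ z′ < N
wraps-twice {N} {y} {z} {z′} s s′ z′<N = ℕ.<⇒≱ z′<N (subst (N ≤_) (sym z′≡z+N) (ℕ.m≤n+m N z))
  where
  z′≡z+N : z′ ≡ z +ℕ N
  z′≡z+N = ℕ.+-cancelˡ-≡ y z′ (z +ℕ N) (trans s′ (trans (cong (_+ℕ N) (sym s)) (ℕ.+-assoc y z N)))

addsTo-unique : ∀ {N y z z′ x} → z < N → z′ < N → AddsTo N y z x → AddsTo N y z′ x → z ≡ z′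
addsTo-unique {y = y} _ _ (inj₁ s) (inj₁ s′) = ℕ.+-cancelˡ-≡ y _ _ (trans s (sym s′))
addsTo-unique {y = y} _ _ (inj₂ s) (inj₂ s′) = ℕ.+-cancelˡ-≡ y _ _ (trans s (sym s′))
addsTo-unique _   z′<N (inj₁ s) (inj₂ s′) = contradiction z′<N (wraps-twice s s′)
addsTo-unique z<N _    (inj₂ s) (inj₁ s′) = contradiction z<N (wraps-twice s′ s)

addsTo-solvable : ∀ {N y x} → y < N → x < N → ∃[ z ] z < N × AddsTo N y z x
addsTo-solvable {N} {y} {x} y<N x<N with y ≤? x
... | yes y≤x = x ∸ y , ℕ.≤-<-trans (ℕ.m∸n≤m x y) x<N , inj₁ (ℕ.m+[n∸m]≡n y≤x)
... | no  y≰x = x +ℕ N ∸ y , z<N , inj₂ (ℕ.m+[n∸m]≡n y≤x+N)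
  where
  y≤x+N : y ≤ x +ℕ N
  y≤x+N = ℕ.≤-trans (ℕ.<⇒≤ y<N) (ℕ.m≤n+m N x)
  z<N : x +ℕ N ∸ y < N
  z<N = subst (x +ℕ N ∸ y <_) (ℕ.m+n∸m≡n y N)
              (ℕ.∸-monoˡ-< (ℕ.+-monoˡ-< N (ℕ.≰⇒> y≰x)) y≤x+N)

addsTo-∣ : ∀ {N y z x d} → d ∣ N → d ∣ y → AddsTo N y z x → d ∣ z ⇔ d ∣ x
addsTo-∣ {d = d} d∣N d∣y (inj₁ s) = mk⇔ (λ d∣z → subst (d ∣_) s (∣m∣n⇒∣m+n d∣y d∣z))
                                        (λ d∣x → ∣m+n∣m⇒∣n (subst (d ∣_) (sym s) d∣x) d∣y)
addsTo-∣ {N} {x = x} {d} d∣N d∣y (inj₂ s) =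
  mk⇔ (λ d∣z → ∣m+n∣m⇒∣n (subst (d ∣_) (trans s (ℕ.+-comm x N)) (∣m∣n⇒∣m+n d∣y d∣z)) d∣N)
      (λ d∣x → ∣m+n∣m⇒∣n (subst (d ∣_) (sym s) (∣m∣n⇒∣m+n d∣x d∣N)) d∣y)

sumℤ-over-solution : ∀ {N} (y x : Fin N) (g : Fin N → ℤ) {v : ℤ} →
                     (∀ z → AddsTo N (toℕ y) (toℕ z) (toℕ x) → g z ≡ v) →
                     sumℤ N (λ z → if addIs N y z x then g z else + 0) ≡ v
sumℤ-over-solution {N} y x g g≡v with addsTo-solvable (Fin.toℕ<n y) (Fin.toℕ<n x)
... | z₀ , z₀<N , s₀ =
  trans (sumℤ-collapse (λ z → addsTo? N (toℕ y) (toℕ z) (toℕ x)) g (fromℕ< z₀<N) s₀′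
          (λ z s → Fin.toℕ-injective (addsTo-unique (Fin.toℕ<n z) (Fin.toℕ<n (fromℕ< z₀<N)) s s₀′)))
        (g≡v (fromℕ< z₀<N) s₀′)
  where
  s₀′ : AddsTo N (toℕ y) (toℕ (fromℕ< z₀<N)) (toℕ x)
  s₀′ = subst (λ z → AddsTo N (toℕ y) z (toℕ x)) (sym (Fin.toℕ-fromℕ< z₀<N)) s₀

⊛-cong : ∀ {N} {f f′ g g′ : RG N} → f ≈ f′ → g ≈ g′ → (f ⊛ g) ≈ (f′ ⊛ g′)
⊛-cong {N} f≈f′ g≈g′ x = sumℤ-cong N (λ y → sumℤ-cong N (λ z →
  cong₂ (λ u v → if addIs N y z x then u * v else + 0) (f≈f′ y) (g≈g′ z)))

⊛-comm : ∀ {N} (f g : RG N) → (f ⊛ g) ≈ (g ⊛ f)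
⊛-comm {N} f g x = begin
  sumℤ N (λ y → sumℤ N (λ z → if addIs N y z x then f y * g z else + 0))
    ≡⟨ sumℤ-comm N N _ ⟩
  sumℤ N (λ z → sumℤ N (λ y → if addIs N y z x then f y * g z else + 0))
    ≡⟨ sumℤ-cong N (λ z → sumℤ-cong N (λ y →
         cong₂ (λ b u → if b then u else + 0) (addIs-comm y z x) (ℤ.*-comm (f y) (g z)))) ⟩
  sumℤ N (λ z → sumℤ N (λ y → if addIs N z y x then g z * f y else + 0)) ∎

⊛-linearˡ : ∀ {N} (a b : ℤ) (f g h : RG N) →
            (((a • f) ⊟ (b • g)) ⊛ h) ≈ ((a • (f ⊛ h)) ⊟ (b • (g ⊛ h)))
⊛-linearˡ {N} a b f g h x =
  trans (sumℤ-cong N (λ y → trans (sumℤ-cong N (λ z → distrib (addIs N y z x) (f y) (g y) (h z)))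
                                  (sumℤ-linear N a b (term f y) (term g y))))
        (sumℤ-linear N a b (λ y → sumℤ N (term f y)) (λ y → sumℤ N (term g y)))
  where
  term : RG N → Fin N → Fin N → ℤ
  term u y z = if addIs N y z x then u y * h z else + 0
  distrib : ∀ β u v w → (if β then (a * u - b * v) * w else + 0)
                        ≡ a * (if β then u * w else + 0) - b * (if β then v * w else + 0)
  distrib true  u v w = *-distribʳ-linear a b u v w
  distrib false u v w = sym (cong₂ _-_ (ℤ.*-zeroʳ a) (ℤ.*-zeroʳ b))

⊛-∑ʳ : ∀ {N} m (c : Fin m → ℤ) (B : Fin m → RG N) (f : RG N) x →
       (f ⊛ (λ z → sumℤ m (λ t → c t * B t z))) x ≡ sumℤ m (λ t → c t * (f ⊛ B t) x)
⊛-∑ʳ {N} m c B f x = begin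
  sumℤ N (λ y → sumℤ N (λ z → if addIs N y z x then f y * sumℤ m (λ t → c t * B t z) else + 0))
    ≡⟨ sumℤ-cong N (λ y → sumℤ-cong N (λ z → expand (addIs N y z x) (f y) z)) ⟩
  sumℤ N (λ y → sumℤ N (λ z → sumℤ m (λ t → c t * term t y z)))
    ≡⟨ sumℤ-cong N (λ y → sumℤ-comm N m _) ⟩
  sumℤ N (λ y → sumℤ m (λ t → sumℤ N (λ z → c t * term t y z)))
    ≡⟨ sumℤ-comm N m _ ⟩
  sumℤ m (λ t → sumℤ N (λ y → sumℤ N (λ z → c t * term t y z)))
    ≡⟨ sumℤ-cong m (λ t → trans (sumℤ-*ˡ N (c t) (λ y → sumℤ N (term t y)))
                                (sumℤ-cong N (λ y → sumℤ-*ˡ N (c t) (term t y)))) ⟨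
  sumℤ m (λ t → c t * (f ⊛ B t) x) ∎
  where
  term : Fin m → Fin N → Fin N → ℤ
  term t y z = if addIs N y z x then f y * B t z else + 0
  expand : ∀ β u z → (if β then u * sumℤ m (λ t → c t * B t z) else + 0)
                     ≡ sumℤ m (λ t → c t * (if β then u * B t z else + 0))
  expand true  u z = trans (sumℤ-*ˡ m u _) (sumℤ-cong m (λ t → x*yz≡y*xz u (c t) (B t z)))
  expand false u z = sym (sumℤ-zero m (λ t → ℤ.*-zeroʳ (c t)))

multiples : ∀ {N} → ℕ → RG N
multiples d x = 𝟙[ d ∣ toℕ x ]

𝟙≈multiples : ∀ {N} → 𝟙 {N} ≈ multiples N
𝟙≈multiples {N} x = cong (λ b → if b then + 1 else + 0) (is-zero (toℕ x) (Fin.toℕ<n x))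
  where
  is-zero : ∀ k → k < N → does (k ≟ 0) ≡ does (N ∣? k)
  is-zero zero    _   = sym (dec-true (N ∣? 0) (N ∣0))
  is-zero (suc k) k<N = sym (dec-false (N ∣? suc k) (λ N∣k → ℕ.<⇒≱ k<N (∣⇒≤ N∣k)))

multiples-⊛ : ∀ {N} d e b .{{_ : NonZero e}} → N ≡ e *ℕ b → d ∣ e →
              (multiples {N} e ⊛ multiples d) ≈ ((+ b) • multiples d)
multiples-⊛ {N} d e b refl d∣e x = begin
  sumℤ N (λ y → sumℤ N (λ z → if addIs N y z x then multiples e y * multiples d z else + 0))
    ≡⟨ sumℤ-cong N (λ y → sumℤ-over-solution y x _ (shift y)) ⟩
  sumℤ N (λ y → multiples e y * multiples d x)
    ≡⟨ sumℤ-*ʳ N (multiples d x) (multiples e) ⟨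
  sumℤ N (multiples e) * multiples d x
    ≡⟨ cong (_* multiples d x) (∑<-𝟙[∣] e b) ⟩
  + b * multiples d x ∎
  where
  shift : ∀ y z → AddsTo N (toℕ y) (toℕ z) (toℕ x) →
          multiples e y * multiples d z ≡ multiples e y * multiples d x
  shift y z s with e ∣? toℕ y
  ... | yes e∣y = cong (+ 1 *_) (𝟙[∣]-cong d (addsTo-∣ (∣-trans d∣e (m∣m*n b)) (∣-trans d∣e e∣y) s))
  ... | no  _   = refl

^-∣ : ∀ q {m n} → m ≤ n → q ^ m ∣ q ^ n
^-∣ q {m} {n} m≤n = divides (q ^ (n ∸ m))
  (trans (cong (q ^_) (sym (ℕ.m∸n+n≡m m≤n))) (ℕ.^-distribˡ-+-* q (n ∸ m) m))

module SubgroupSums (q : ℕ) .{{_ : NonZero q}} (r : ℕ) where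

  Sig-⊛-Sig-≤ : ∀ {s t} → s ≤ t → t ≤ r → (Sig q r s ⊛ Sig q r t) ≈ ((+ (q ^ s)) • Sig q r t)
  Sig-⊛-Sig-≤ {s} {t} s≤t t≤r =
    multiples-⊛ (q ^ (r ∸ t)) (q ^ (r ∸ s)) (q ^ s) {{ℕ.m^n≢0 q (r ∸ s)}}
                qʳ≡ (^-∣ q (ℕ.∸-monoʳ-≤ r s≤t))
    where
    qʳ≡ : q ^ r ≡ q ^ (r ∸ s) *ℕ q ^ s
    qʳ≡ = trans (cong (q ^_) (sym (ℕ.m∸n+n≡m (ℕ.≤-trans s≤t t≤r)))) (ℕ.^-distribˡ-+-* q (r ∸ s) s)

  Sig-⊛-Sig : ∀ {s t} → s ≤ r → t ≤ r →
              (Sig q r s ⊛ Sig q r t) ≈ ((+ (q ^ (s ⊓ t))) • Sig q r (s ⊔ t))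
  Sig-⊛-Sig {s} {t} s≤r t≤r x with ℕ.≤-total s t
  ... | inj₁ s≤t rewrite ℕ.m≤n⇒m⊓n≡m s≤t | ℕ.m≤n⇒m⊔n≡n s≤t = Sig-⊛-Sig-≤ s≤t t≤r x
  ... | inj₂ t≤s rewrite ℕ.m≥n⇒m⊓n≡n t≤s | ℕ.m≥n⇒m⊔n≡m t≤s =
    trans (⊛-comm (Sig q r s) (Sig q r t) x) (Sig-⊛-Sig-≤ t≤s s≤r x)

  ⟨_,_⟩ : (ℕ → ℤ) → (ℕ → ℤ) → ℤ
  ⟨ c , φ ⟩ = ∑< (suc r) (λ t → c t * φ t)

  ⟦_⟧ : (ℕ → ℤ) → RG (q ^ r)
  ⟦ c ⟧ x = ⟨ c , (λ t → Sig q r t x) ⟩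

  ⟨⟩-linear : ∀ a b c c′ φ → ⟨ (λ t → a * c t - b * c′ t) , φ ⟩ ≡ a * ⟨ c , φ ⟩ - b * ⟨ c′ , φ ⟩
  ⟨⟩-linear a b c c′ φ =
    trans (∑<-cong (suc r) (λ t _ → *-distribʳ-linear a b (c t) (c′ t) (φ t)))
          (sumℤ-linear (suc r) a b (λ t → c (toℕ t) * φ (toℕ t)) (λ t → c′ (toℕ t) * φ (toℕ t)))

  ⟨⟩-*ʳ : ∀ a c φ → ⟨ c , (λ t → a * φ t) ⟩ ≡ a * ⟨ c , φ ⟩
  ⟨⟩-*ʳ a c φ = trans (∑<-cong (suc r) (λ t _ → x*yz≡y*xz (c t) a (φ t)))
                      (sym (sumℤ-*ˡ (suc r) a (λ t → c (toℕ t) * φ (toℕ t))))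

  Sig-mul : ℕ → (ℕ → ℤ) → ℕ → ℤ
  Sig-mul s c = pushforward (suc r) (s ⊔_) (λ t → + (q ^ (s ⊓ t)) * c t)

  ⟨Sig-mul⟩ : ∀ {s} → s ≤ r → ∀ c φ →
              ⟨ Sig-mul s c , φ ⟩ ≡ ⟨ c , (λ t → + (q ^ (s ⊓ t)) * φ (s ⊔ t)) ⟩
  ⟨Sig-mul⟩ {s} s≤r c φ =
    trans (∑<-pushforward (suc r) (suc r) (s ⊔_) (λ t → + (q ^ (s ⊓ t)) * c t) φ
                          (λ t t<1+r → s≤s (ℕ.⊔-lub s≤r (ℕ.≤-pred t<1+r))))
          (∑<-cong (suc r) (λ t _ → xy*z≡y*xz (+ (q ^ (s ⊓ t))) (c t) (φ (s ⊔ t))))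

  ⟦⟧-Sig-mul : ∀ {s} → s ≤ r → ∀ c → (Sig q r s ⊛ ⟦ c ⟧) ≈ ⟦ Sig-mul s c ⟧
  ⟦⟧-Sig-mul {s} s≤r c x = begin
    (Sig q r s ⊛ ⟦ c ⟧) x
      ≡⟨ ⊛-∑ʳ (suc r) (c ∘ toℕ) (Sig q r ∘ toℕ) (Sig q r s) x ⟩
    ⟨ c , (λ t → (Sig q r s ⊛ Sig q r t) x) ⟩
      ≡⟨ ∑<-cong (suc r) (λ t t<1+r → cong (c t *_) (Sig-⊛-Sig s≤r (ℕ.≤-pred t<1+r) x)) ⟩
    ⟨ c , (λ t → + (q ^ (s ⊓ t)) * Sig q r (s ⊔ t) x) ⟩
      ≡⟨ ⟨Sig-mul⟩ s≤r c (λ t → Sig q r t x) ⟨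
    ⟦ Sig-mul s c ⟧ x ∎

  𝟙-⊛-⟦⟧ : ∀ c → (𝟙 ⊛ ⟦ c ⟧) ≈ ⟦ c ⟧
  𝟙-⊛-⟦⟧ c x = begin
    (𝟙 ⊛ ⟦ c ⟧) x                       ≡⟨ ⊛-cong 𝟙≈multiples (λ _ → refl) x ⟩
    (Sig q r 0 ⊛ ⟦ c ⟧) x               ≡⟨ ⟦⟧-Sig-mul z≤n c x ⟩
    ⟦ Sig-mul 0 c ⟧ x                   ≡⟨ ⟨Sig-mul⟩ z≤n c (λ t → Sig q r t x) ⟩
    ⟨ c , (λ t → + 1 * Sig q r t x) ⟩   ≡⟨ ∑<-cong (suc r) {h = λ t → c t * Sig q r t x}
                                                   (λ t _ → cong (c t *_) (ℤ.*-identityˡ _)) ⟩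
    ⟦ c ⟧ x                             ∎

  -- A character of G of order q^(r ∸ j) is trivial exactly on the subgroups of
  -- order q^t with t ≤ j, so it sends Σ_⟨q^t⟩ to ψ j t.
  ψ : ℕ → ℕ → ℤ
  ψ j t = if does (t ≤? j) then + (q ^ t) else + 0

  ψ-≤ : ∀ j {s t} → s ≤ t → + (q ^ s) * ψ j t ≡ ψ j s * ψ j t
  ψ-≤ j {s} {t} s≤t with t ≤? j
  ... | yes t≤j = cong₂ _*_ (sym (if-yes (s ≤? j) (ℕ.≤-trans s≤t t≤j))) refl
  ... | no  t≰j = begin
    + (q ^ s) * ψ j t  ≡⟨ cong (+ (q ^ s) *_) (if-no (t ≤? j) t≰j) ⟩
    + (q ^ s) * + 0    ≡⟨ ℤ.*-zeroʳ (+ (q ^ s)) ⟩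
    + 0                ≡⟨ ℤ.*-zeroʳ (ψ j s) ⟨
    ψ j s * + 0        ≡⟨ cong (ψ j s *_) (if-no (t ≤? j) t≰j) ⟨
    ψ j s * ψ j t      ∎

  ψ-⊓⊔ : ∀ j s t → + (q ^ (s ⊓ t)) * ψ j (s ⊔ t) ≡ ψ j s * ψ j t
  ψ-⊓⊔ j s t with ℕ.≤-total s t
  ... | inj₁ s≤t rewrite ℕ.m≤n⇒m⊓n≡m s≤t | ℕ.m≤n⇒m⊔n≡n s≤t = ψ-≤ j s≤t
  ... | inj₂ t≤s rewrite ℕ.m≥n⇒m⊓n≡n t≤s | ℕ.m≥n⇒m⊔n≡m t≤s =
    trans (ψ-≤ j t≤s) (ℤ.*-comm (ψ j t) (ψ j s))

  ψ-Sig-mul : ∀ {s} → s ≤ r → ∀ c j → ⟨ Sig-mul s c , ψ j ⟩ ≡ ψ j s * ⟨ c , ψ j ⟩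
  ψ-Sig-mul {s} s≤r c j = begin
    ⟨ Sig-mul s c , ψ j ⟩
      ≡⟨ ⟨Sig-mul⟩ s≤r c (ψ j) ⟩
    ⟨ c , (λ t → + (q ^ (s ⊓ t)) * ψ j (s ⊔ t)) ⟩
      ≡⟨ ∑<-cong (suc r) (λ t _ → cong (c t *_) (ψ-⊓⊔ j s t)) ⟩
    ⟨ c , (λ t → ψ j s * ψ j t) ⟩
      ≡⟨ ⟨⟩-*ʳ (ψ j s) c (ψ j) ⟩
    ψ j s * ⟨ c , ψ j ⟩ ∎

  factor : ℤ → ℤ → ℕ → RG (q ^ r)
  factor a b s = (a • 𝟙) ⊟ (b • Sig q r s)

  factorCoeffs : ℤ → ℤ → ℕ → (ℕ → ℤ) → ℕ → ℤ
  factorCoeffs a b s c t = a * c t - b * Sig-mul s c t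

  factor-⊛-⟦⟧ : ∀ a b {s} → s ≤ r → ∀ c → (factor a b s ⊛ ⟦ c ⟧) ≈ ⟦ factorCoeffs a b s c ⟧
  factor-⊛-⟦⟧ a b {s} s≤r c x = begin
    (factor a b s ⊛ ⟦ c ⟧) x
      ≡⟨ ⊛-linearˡ a b 𝟙 (Sig q r s) ⟦ c ⟧ x ⟩
    a * (𝟙 ⊛ ⟦ c ⟧) x - b * (Sig q r s ⊛ ⟦ c ⟧) x
      ≡⟨ cong₂ (λ u v → a * u - b * v) (𝟙-⊛-⟦⟧ c x) (⟦⟧-Sig-mul s≤r c x) ⟩
    a * ⟦ c ⟧ x - b * ⟦ Sig-mul s c ⟧ x
      ≡⟨ ⟨⟩-linear a b c (Sig-mul s c) (λ t → Sig q r t x) ⟨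
    ⟦ factorCoeffs a b s c ⟧ x ∎

  ψ-factorCoeffs : ∀ a b {s} → s ≤ r → ∀ c j →
                   ⟨ factorCoeffs a b s c , ψ j ⟩ ≡ (a - b * ψ j s) * ⟨ c , ψ j ⟩
  ψ-factorCoeffs a b {s} s≤r c j = begin
    ⟨ factorCoeffs a b s c , ψ j ⟩
      ≡⟨ ⟨⟩-linear a b c (Sig-mul s c) (ψ j) ⟩
    a * ⟨ c , ψ j ⟩ - b * ⟨ Sig-mul s c , ψ j ⟩
      ≡⟨ cong (λ v → a * ⟨ c , ψ j ⟩ - b * v) (ψ-Sig-mul s≤r c j) ⟩
    a * ⟨ c , ψ j ⟩ - b * (ψ j s * ⟨ c , ψ j ⟩)
      ≡⟨ factor-out a b (ψ j s) ⟨ c , ψ j ⟩ ⟩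
    (a - b * ψ j s) * ⟨ c , ψ j ⟩ ∎
    where
    factor-out : ∀ a b u v → a * v - b * (u * v) ≡ (a - b * u) * v
    factor-out = solve-∀

  unit : ℕ → ℤ
  unit zero    = + 1
  unit (suc _) = + 0

  ⟨unit⟩ : ∀ φ → ⟨ unit , φ ⟩ ≡ φ 0
  ⟨unit⟩ φ =
    trans (cong₂ _+_ (ℤ.*-identityˡ (φ 0)) (∑<-zero r (λ _ _ → refl))) (ℤ.+-identityʳ (φ 0))

  prodCoeffs : ∀ n → (Fin n → ℤ) → (Fin n → ℤ) → (Fin n → ℕ) → ℕ → ℤ
  prodCoeffs zero    a b s = unit
  prodCoeffs (suc n) a b s =
    factorCoeffs (a zero) (b zero) (s zero) (prodCoeffs n (a ∘ suc) (b ∘ suc) (s ∘ suc))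

  prodRG-factor : ∀ n a b s → (∀ k → s k ≤ r) →
                  prodRG n (λ k → factor (a k) (b k) (s k)) ≈ ⟦ prodCoeffs n a b s ⟧
  prodRG-factor zero    a b s _   x = trans (𝟙≈multiples x) (sym (⟨unit⟩ (λ t → Sig q r t x)))
  prodRG-factor (suc n) a b s s≤r x =
    trans (⊛-cong {f = factor (a zero) (b zero) (s zero)} (λ _ → refl)
                  (prodRG-factor n (a ∘ suc) (b ∘ suc) (s ∘ suc) (s≤r ∘ suc)) x)
          (factor-⊛-⟦⟧ (a zero) (b zero) (s≤r zero) (prodCoeffs n (a ∘ suc) (b ∘ suc) (s ∘ suc)) x)

  ψ-prodCoeffs : ∀ n a b s → (∀ k → s k ≤ r) → ∀ j →
                 ⟨ prodCoeffs n a b s , ψ j ⟩ ≡ prodℤ n (λ k → a k - b k * ψ j (s k))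
  ψ-prodCoeffs zero    a b s _   j = ⟨unit⟩ (ψ j)
  ψ-prodCoeffs (suc n) a b s s≤r j =
    trans (ψ-factorCoeffs (a zero) (b zero) (s≤r zero)
                          (prodCoeffs n (a ∘ suc) (b ∘ suc) (s ∘ suc)) j)
          (cong ((a zero - b zero * ψ j (s zero)) *_)
                (ψ-prodCoeffs n (a ∘ suc) (b ∘ suc) (s ∘ suc) (s≤r ∘ suc) j))

  factor-ψ : ∀ {x h i} j → x ≡ suc (h *ℕ q ^ i) →
             + x - + h * ψ j i ≡ + (if does (i ≤? j) then 1 else x)
  factor-ψ {x} {h} {i} j x≡1+hq^i =
    if-elim (λ v → + x - + h * ψ j i ≡ + v) (i ≤? j) unramified ramified
    where
    [x+y]-y≡x : ∀ x y → x + y - y ≡ x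
    [x+y]-y≡x = solve-∀
    unramified : i ≤ j → + x - + h * ψ j i ≡ + 1
    unramified i≤j = begin
      + x - + h * ψ j i                      ≡⟨ cong (λ v → + x - + h * v) (if-yes (i ≤? j) i≤j) ⟩
      + x - + h * + (q ^ i)                  ≡⟨ cong (λ y → + y - + h * + (q ^ i)) x≡1+hq^i ⟩
      + 1 + + (h *ℕ q ^ i) - + h * + (q ^ i)
        ≡⟨ cong (λ z → + 1 + z - + h * + (q ^ i)) (ℤ.pos-* h (q ^ i)) ⟩
      + 1 + + h * + (q ^ i) - + h * + (q ^ i) ≡⟨ [x+y]-y≡x (+ 1) (+ h * + (q ^ i)) ⟩
      + 1                                    ∎
    ramified : ¬ i ≤ j → + x - + h * ψ j i ≡ + x
    ramified i≰j = begin
      + x - + h * ψ j i  ≡⟨ cong (λ v → + x - + h * v) (if-no (i ≤? j) i≰j) ⟩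
      + x - + h * + 0    ≡⟨ cong (λ v → + x - v) (ℤ.*-zeroʳ (+ h)) ⟩
      + x + + 0          ≡⟨ ℤ.+-identityʳ (+ x) ⟩
      + x                ∎

  ⟨⟩-ψ-zero : ∀ c → ⟨ c , ψ 0 ⟩ ≡ c 0
  ⟨⟩-ψ-zero c = trans (cong₂ _+_ (ℤ.*-identityʳ (c 0)) (∑<-zero r (λ t _ → ℤ.*-zeroʳ (c (suc t)))))
                      (ℤ.+-identityʳ (c 0))

  ψ-suc : ∀ j t → ψ (suc j) t ≡ ψ j t + (if does (t ≟ suc j) then + (q ^ t) else + 0)
  ψ-suc j t with t ≟ suc j
  ... | yes refl =
    trans (if-yes (suc j ≤? suc j) ℕ.≤-refl)
          (sym (cong₂ _+_ (if-no (suc j ≤? j) (ℕ.n≮n j)) (if-yes (suc j ≟ suc j) refl)))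
  ... | no t≢1+j =
    trans (cong (λ b → if b then + (q ^ t) else + 0) (does-⇔ t≤1+j⇔t≤j (t ≤? suc j) (t ≤? j)))
          (sym (trans (cong (_+_ (ψ j t)) (if-no (t ≟ suc j) t≢1+j)) (ℤ.+-identityʳ (ψ j t))))
    where
    t≤1+j⇔t≤j : t ≤ suc j ⇔ t ≤ j
    t≤1+j⇔t≤j = mk⇔ (λ t≤1+j → ℕ.≤-pred (ℕ.≤∧≢⇒< t≤1+j t≢1+j)) ℕ.m≤n⇒m≤1+n

  ⟨⟩-ψ-suc : ∀ c {j} → suc j ≤ r → ⟨ c , ψ (suc j) ⟩ ≡ ⟨ c , ψ j ⟩ + c (suc j) * + (q ^ suc j)
  ⟨⟩-ψ-suc c {j} j<r = begin
    ⟨ c , ψ (suc j) ⟩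
      ≡⟨ ∑<-cong (suc r) (λ t _ → split t) ⟩
    ∑< (suc r) (λ t → c t * ψ j t + (if does (t ≟ suc j) then c t * + (q ^ t) else + 0))
      ≡⟨ ∑<-+ (suc r) (λ t → c t * ψ j t)
                      (λ t → if does (t ≟ suc j) then c t * + (q ^ t) else + 0) ⟩
    ⟨ c , ψ j ⟩ + ∑< (suc r) (λ t → if does (t ≟ suc j) then c t * + (q ^ t) else + 0)
      ≡⟨ cong (_+_ ⟨ c , ψ j ⟩) (∑<-δ (s≤s j<r) (λ t → c t * + (q ^ t))) ⟩
    ⟨ c , ψ j ⟩ + c (suc j) * + (q ^ suc j) ∎
    where
    split : ∀ t → c t * ψ (suc j) t
                  ≡ c t * ψ j t + (if does (t ≟ suc j) then c t * + (q ^ t) else + 0)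
    split t = begin
      c t * ψ (suc j) t
        ≡⟨ cong (c t *_) (ψ-suc j t) ⟩
      c t * (ψ j t + (if does (t ≟ suc j) then + (q ^ t) else + 0))
        ≡⟨ ℤ.*-distribˡ-+ (c t) (ψ j t) _ ⟩
      c t * ψ j t + c t * (if does (t ≟ suc j) then + (q ^ t) else + 0)
        ≡⟨ cong (_+_ (c t * ψ j t)) (*-if-zeroˡ (does (t ≟ suc j)) (c t) (+ (q ^ t))) ⟩
      c t * ψ j t + (if does (t ≟ suc j) then c t * + (q ^ t) else + 0) ∎

  ψ-determines : ∀ c c′ → (∀ j → j ≤ r → ⟨ c , ψ j ⟩ ≡ ⟨ c′ , ψ j ⟩) → ∀ t → t ≤ r → c t ≡ c′ t
  ψ-determines c c′ same zero    _   = trans (sym (⟨⟩-ψ-zero c)) (trans (same 0 z≤n) (⟨⟩-ψ-zero c′))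
  ψ-determines c c′ same (suc t) t<r =
    ℤ.*-cancelʳ-≡ (c (suc t)) (c′ (suc t)) (+ (q ^ suc t)) {{ℕ.m^n≢0 q (suc t)}} (begin
      c (suc t) * + (q ^ suc t)           ≡⟨ difference c ⟩
      ⟨ c , ψ (suc t) ⟩ - ⟨ c , ψ t ⟩     ≡⟨ cong₂ _-_ (same (suc t) t<r) (same t (ℕ.<⇒≤ t<r)) ⟩
      ⟨ c′ , ψ (suc t) ⟩ - ⟨ c′ , ψ t ⟩   ≡⟨ difference c′ ⟨
      c′ (suc t) * + (q ^ suc t)          ∎)
    where
    difference : ∀ c → c (suc t) * + (q ^ suc t) ≡ ⟨ c , ψ (suc t) ⟩ - ⟨ c , ψ t ⟩
    difference c = trans (x≡y+x-y _ ⟨ c , ψ t ⟩) (cong (_- ⟨ c , ψ t ⟩) (sym (⟨⟩-ψ-suc c t<r)))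
      where x≡y+x-y : ∀ x y → x ≡ y + x - y
            x≡y+x-y = solve-∀

  ⟦⟧-unique : ∀ c c′ → (∀ j → j ≤ r → ⟨ c , ψ j ⟩ ≡ ⟨ c′ , ψ j ⟩) → ⟦ c ⟧ ≈ ⟦ c′ ⟧
  ⟦⟧-unique c c′ same x =
    ∑<-cong (suc r) {λ t → c t * Sig q r t x} {λ t → c′ t * Sig q r t x}
            (λ t t<1+r → cong (_* Sig q r t x) (ψ-determines c c′ same t (ℕ.≤-pred t<1+r)))

∣pred⇒≡1+* : ∀ {a d} → 1 ≤ a → d ∣ a ∸ 1 → ∃[ u ] a ≡ suc (u *ℕ d)
∣pred⇒≡1+* 1≤a (divides u a∸1≡u*d) = u , trans (sym (ℕ.m+[n∸m]≡n 1≤a)) (cong suc a∸1≡u*d)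

prodℕ-≡1+* : ∀ {d} n (f : Fin n → ℕ) → (∀ k → ∃[ u ] f k ≡ suc (u *ℕ d)) →
             ∃[ u ] prodℕ n f ≡ suc (u *ℕ d)
prodℕ-≡1+* zero    f _ = 0 , refl
prodℕ-≡1+* {d} (suc n) f f≡1+* with f≡1+* zero | prodℕ-≡1+* n (f ∘ suc) (f≡1+* ∘ suc)
... | u , fu | v , fv = u +ℕ v +ℕ u *ℕ v *ℕ d , trans (cong₂ _*ℕ_ fu fv) (expand u v d)
  where
  expand : ∀ u v d → suc (u *ℕ d) *ℕ suc (v *ℕ d) ≡ suc ((u +ℕ v +ℕ u *ℕ v *ℕ d) *ℕ d)
  expand = ℕ-Solver.solve-∀

telescope : ∀ f Q M → + (suc (f *ℕ Q) *ℕ M) + - + (f *ℕ M) * + Q ≡ + M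
telescope f Q M = begin
  + (suc (f *ℕ Q) *ℕ M) + - + (f *ℕ M) * + Q
    ≡⟨ cong₂ (λ u v → u + - v * + Q) (ℤ.pos-* (suc (f *ℕ Q)) M) (ℤ.pos-* f M) ⟩
  (+ 1 + + (f *ℕ Q)) * + M + - (+ f * + M) * + Q
    ≡⟨ cong (λ u → (+ 1 + u) * + M + - (+ f * + M) * + Q) (ℤ.pos-* f Q) ⟩
  (+ 1 + + f * + Q) * + M + - (+ f * + M) * + Q
    ≡⟨ cancel (+ f) (+ Q) (+ M) ⟩
  + M ∎
  where
  cancel : ∀ f Q M → (+ 1 + f * Q) * M + - (f * M) * Q ≡ M
  cancel = solve-∀

module Ramification (q : ℕ) (pq : Prime q) (r : ℕ) {n : ℕ} (p ι : Fin n → ℕ)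
                   (p≥1 : ∀ k → 1 ≤ p k) (ι≥1 : ∀ k → 1 ≤ ι k) (ι≤r : ∀ k → ι k ≤ r)
                   (q^ι∣p∸1 : ∀ k → q ^ ι k ∣ p k ∸ 1) where

  private instance
    q≢0 : NonZero q
    q≢0 = prime⇒nonZero pq

  open SubgroupSums q r

  ≡1+divPow* : ∀ {a} i → 1 ≤ a → q ^ i ∣ a ∸ 1 → a ≡ suc (divPow q pq (a ∸ 1) i *ℕ q ^ i)
  ≡1+divPow* i 1≤a q^i∣a∸1 =
    trans (sym (ℕ.m+[n∸m]≡n 1≤a)) (cong suc (sym (m/n*n≡m {{ℕ.m^n≢0 q i}} q^i∣a∸1)))

  p≡1+hh* : ∀ k → p k ≡ suc (hh q pq p ι k *ℕ q ^ ι k)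
  p≡1+hh* k = ≡1+divPow* (ι k) (p≥1 k) (q^ι∣p∸1 k)

  mm≡1+ff* : ∀ t → mm p ι t ≡ suc (ff q pq p ι t *ℕ q ^ t)
  mm≡1+ff* t with prodℕ-≡1+* n _ factor≡1+*
    where
    factor≡1+* : ∀ k → ∃[ u ] (if does (ι k ≟ t) then p k else 1) ≡ suc (u *ℕ q ^ t)
    factor≡1+* k = if-elim (λ v → ∃[ u ] v ≡ suc (u *ℕ q ^ t)) (ι k ≟ t)
                           (λ { refl → ∣pred⇒≡1+* (p≥1 k) (q^ι∣p∸1 k) }) (λ _ → 0 , refl)
  ... | u , mm≡ = ≡1+divPow* t (subst (1 ≤_) (sym mm≡) (s≤s z≤n)) (divides u (cong (_∸ 1) mm≡))

  -- m_(j+1) ⋯ m_r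
  productAbove : ℕ → ℕ
  productAbove j = prodℕ n (λ k → if does (ι k ≤? j) then 1 else p k)

  productAbove-zero : productAbove 0 ≡ prodℕ n p
  productAbove-zero = sumFin-cong _*ℕ_ 1 n (λ k → if-no (ι k ≤? 0) (ℕ.<⇒≱ (ι≥1 k)))

  productAbove-suc : ∀ j → productAbove j ≡ mm p ι (suc j) *ℕ productAbove (suc j)
  productAbove-suc j = trans (sumFin-cong _*ℕ_ 1 n (λ k → split (ι k) (p k))) (prodℕ-* n _ _)
    where
    split : ∀ i x → (if does (i ≤? j) then 1 else x)
                    ≡ (if does (i ≟ suc j) then x else 1) *ℕ (if does (i ≤? suc j) then 1 else x)
    split i x with ℕ.<-cmp i (suc j)
    ... | tri< i<1+j i≢1+j _ =
      trans (if-yes (i ≤? j) (ℕ.≤-pred i<1+j))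
            (sym (cong₂ _*ℕ_ (if-no (i ≟ suc j) i≢1+j) (if-yes (i ≤? suc j) (ℕ.<⇒≤ i<1+j))))
    ... | tri≈ _ refl _ =
      trans (if-no (suc j ≤? j) (ℕ.n≮n j))
            (sym (trans (cong₂ _*ℕ_ (if-yes (suc j ≟ suc j) refl)
                                    (if-yes (suc j ≤? suc j) ℕ.≤-refl))
                        (ℕ.*-identityʳ x)))
    ... | tri> _ i≢1+j 1+j<i =
      trans (if-no (i ≤? j) (ℕ.<⇒≱ (ℕ.<-trans (ℕ.n<1+n j) 1+j<i)))
            (sym (trans (cong₂ _*ℕ_ (if-no (i ≟ suc j) i≢1+j) (if-no (i ≤? suc j) (ℕ.<⇒≱ 1+j<i)))
                        (ℕ.+-identityʳ x)))

  productAbove≡mmAbove : ∀ j → productAbove j ≡ mmAbove p ι r j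
  productAbove≡mmAbove j = go (r ∸ j) j refl
    where
    go : ∀ d j → r ∸ j ≡ d → productAbove j ≡ prodℕ d (λ t → mm p ι (j +ℕ suc (toℕ t)))
    go zero    j r∸j≡0   =
      prodℕ-ones n (λ k → if-yes (ι k ≤? j) (ℕ.≤-trans (ι≤r k) (ℕ.m∸n≡0⇒m≤n r∸j≡0)))
    go (suc d) j r∸j≡1+d = begin
      productAbove j
        ≡⟨ productAbove-suc j ⟩
      mm p ι (suc j) *ℕ productAbove (suc j)
        ≡⟨ cong₂ _*ℕ_ (cong (mm p ι) (ℕ.+-comm 1 j))
                      (go d (suc j) (trans (sym (ℕ.pred[m∸n]≡m∸[1+n] r j)) (cong pred r∸j≡1+d))) ⟩
      mm p ι (j +ℕ 1) *ℕ prodℕ d (λ t → mm p ι (suc j +ℕ suc (toℕ t)))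
        ≡⟨ cong (mm p ι (j +ℕ 1) *ℕ_)
                (sumFin-cong _*ℕ_ 1 d (λ t → cong (mm p ι) (sym (ℕ.+-suc j (suc (toℕ t)))))) ⟩
      prodℕ (suc d) (λ t → mm p ι (j +ℕ suc (toℕ t))) ∎

  lhsCoeffs : ℕ → ℤ
  lhsCoeffs = prodCoeffs n (λ k → + p k) (λ k → + hh q pq p ι k) ι

  LHS≈⟦lhsCoeffs⟧ : LHS q pq r n p ι ≈ ⟦ lhsCoeffs ⟧
  LHS≈⟦lhsCoeffs⟧ = prodRG-factor n (λ k → + p k) (λ k → + hh q pq p ι k) ι ι≤r

  ψ-lhsCoeffs : ∀ j → ⟨ lhsCoeffs , ψ j ⟩ ≡ + productAbove j
  ψ-lhsCoeffs j = begin
    ⟨ lhsCoeffs , ψ j ⟩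
      ≡⟨ ψ-prodCoeffs n (λ k → + p k) (λ k → + hh q pq p ι k) ι ι≤r j ⟩
    prodℤ n (λ k → + p k - + hh q pq p ι k * ψ j (ι k))
      ≡⟨ sumFin-cong _*_ (+ 1) n (λ k → factor-ψ {h = hh q pq p ι k} {i = ι k} j (p≡1+hh* k)) ⟩
    prodℤ n (λ k → + (if does (ι k ≤? j) then 1 else p k))
      ≡⟨ sumFin-homo +_ refl ℤ.pos-* n (λ k → if does (ι k ≤? j) then 1 else p k) ⟨
    + productAbove j ∎

  rhsCoeffs : ℕ → ℤ
  rhsCoeffs zero    = a₀ p
  rhsCoeffs (suc t) = aa q pq p ι r (suc t)

  RHS≈⟦rhsCoeffs⟧ : RHS q pq r n p ι ≈ ⟦ rhsCoeffs ⟧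
  RHS≈⟦rhsCoeffs⟧ x = cong₂ _+_ (cong (a₀ p *_) (𝟙≈multiples x))
    (sumFin-homo (λ F → F x) refl (λ _ _ → refl) r
                 (λ t → aa q pq p ι r (suc (toℕ t)) • Sig q r (suc (toℕ t))))

  ψ-rhsCoeffs : ∀ j → j ≤ r → ⟨ rhsCoeffs , ψ j ⟩ ≡ + productAbove j
  ψ-rhsCoeffs zero    _   = trans (⟨⟩-ψ-zero rhsCoeffs) (cong +_ (sym productAbove-zero))
  ψ-rhsCoeffs (suc j) j<r = begin
    ⟨ rhsCoeffs , ψ (suc j) ⟩
      ≡⟨ ⟨⟩-ψ-suc rhsCoeffs j<r ⟩
    ⟨ rhsCoeffs , ψ j ⟩ + - + (f *ℕ mmAbove p ι r (suc j)) * + Q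
      ≡⟨ cong₂ (λ u v → u + - + (f *ℕ v) * + Q) (ψ-rhsCoeffs j (ℕ.<⇒≤ j<r))
                                                (sym (productAbove≡mmAbove (suc j))) ⟩
    + productAbove j + - + (f *ℕ M) * + Q
      ≡⟨ cong (λ u → + u + - + (f *ℕ M) * + Q)
              (trans (productAbove-suc j) (cong (_*ℕ M) (mm≡1+ff* (suc j)))) ⟩
    + (suc (f *ℕ Q) *ℕ M) + - + (f *ℕ M) * + Q
      ≡⟨ telescope f Q M ⟩
    + M ∎
    where
    f Q M : ℕ
    f = ff q pq p ι (suc j)
    Q = q ^ suc j
    M = productAbove (suc j)

  LHS≈RHS : LHS q pq r n p ι ≈ RHS q pq r n p ι
  LHS≈RHS x = begin
    LHS q pq r n p ι x  ≡⟨ LHS≈⟦lhsCoeffs⟧ x ⟩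
    ⟦ lhsCoeffs ⟧ x     ≡⟨ ⟦⟧-unique lhsCoeffs rhsCoeffs same-ψ x ⟩
    ⟦ rhsCoeffs ⟧ x     ≡⟨ RHS≈⟦rhsCoeffs⟧ x ⟨
    RHS q pq r n p ι x  ∎
    where
    same-ψ : ∀ j → j ≤ r → ⟨ lhsCoeffs , ψ j ⟩ ≡ ⟨ rhsCoeffs , ψ j ⟩
    same-ψ j j≤r = trans (ψ-lhsCoeffs j) (sym (ψ-rhsCoeffs j j≤r))

lemma3p7 : (q : ℕ) (pq : Prime q) → q ≢ 2 → (r : ℕ) → 1 ≤ r →
    (n : ℕ) (p : Fin n → ℕ) (ι : Fin n → ℕ) →
    (∀ k → Prime (p k)) → Injective _≡_ _≡_ p →
    (∀ k → 1 ≤ ι k) → (∀ k → ι k ≤ r) →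
    (∀ k → q ^ ι k ∣ p k ∸ 1) →
    LHS q pq r n p ι ≈ RHS q pq r n p ι
lemma3p7 q pq _ r _ n p ι p-prime _ ι≥1 ι≤r q^ι∣p∸1 =
  Ramification.LHS≈RHS q pq r p ι p≥1 ι≥1 ι≤r q^ι∣p∸1
  where
  p≥1 : ∀ k → 1 ≤ p k
  p≥1 k = >-nonZero⁻¹ (p k) {{prime⇒nonZero (p-prime k)}}
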